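{- Let $G$ be a connected graph such that $D(G^c)=2$. Then: (1) $\operatorname{Sd}_s(G,G^c)=\dim_s(G)$ if and only if there exists a strong metric generator of $G$ of cardinality $\dim_s(G)$ which is a vertex cover of $G$; (2) $\operatorname{Sd}_s(G,G^c)=\beta(G)$ if and only if there exists a vertex cover of $G$ of cardinality $\beta(G)$ which is a strong metric generator of $G$.
   Context: All graphs are finite, simple and undirected; $G^c$ denotes the complement of $G$ on the same vertex set and $D(H)$ the diameter of a connected graph $H$. For a connected graph $H$, $d_H(x,y)$ is the length of a shortest $x$–$y$ path; a vertex $w$ strongly resolves $u,v$ if $d_H(u,w)=d_H(u,v)+d_H(v,w)$ or $d_H(v,w)=d_H(v,u)+d_H(u,w)$; a set $S\subseteq V(H)$ is a strong metric generator for $H$ if every two distinct vertices are strongly resolved by some vertex of $S$, and $\dim_s(H)$ is the minimum cardinality of such a set. For connected graphs $G_1,\dots,G_k$ on a common vertex set $V$, $\operatorname{Sd}_s(G_1,\dots,G_k)$ is the minimum cardinality of a set $S\subseteq V$ that is a strong metric generator for every $G_i$. A vertex cover of $G$ is a set of vertices meeting every edge, and $\beta(G)$ is the minimum cardinality of a vertex cover. -}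

module Defs where

open import Data.Nat using (ℕ; zero; suc; _+_; _≤_; _<_)
open import Data.Fin using (Fin; _≟_)
open import Data.Fin.Subset using (Subset; _∈_; ∣_∣)
open import Data.Bool using (Bool; true; false; not; _∧_)
open import Data.Product using (Σ; ∃; ∃-syntax; _×_; _,_)
open import Data.Sum using (_⊎_)
open import Relation.Nullary using (¬_; yes; no)
open import Relation.Nullary.Decidable using (⌊_⌋)
open import Relation.Binary.PropositionalEquality using (_≡_; _≢_; refl; sym)

record Graph (n : ℕ) : Set where
  field
    E      : Fin n → Fin n → Bool
    E-sym  : ∀ x y → E x y ≡ E y x
    E-irr  : ∀ x → E x x ≡ false
open Graph public

private
  ⌊≟⌋-sym : ∀ {n} (x y : Fin n) → ⌊ x ≟ y ⌋ ≡ ⌊ y ≟ x ⌋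
  ⌊≟⌋-sym x y with x ≟ y | y ≟ x
  ... | yes _ | yes _ = refl
  ... | no _  | no _  = refl
  ... | yes p | no q  with q (sym p)
  ... | ()
  ⌊≟⌋-sym x y | no p | yes q with p (sym q)
  ... | ()

  ⌊≟⌋-refl : ∀ {n} (x : Fin n) → ⌊ x ≟ x ⌋ ≡ true
  ⌊≟⌋-refl x with x ≟ x
  ... | yes _ = refl
  ... | no p with p refl
  ... | ()

  ∧-false : ∀ b → b ∧ false ≡ false
  ∧-false true = refl
  ∧-false false = refl

complement : ∀ {n} → Graph n → Graph n
complement G = record
  { E     = λ x y → not (E G x y) ∧ not ⌊ x ≟ y ⌋
  ; E-sym = λ x y → symm x y
  ; E-irr = λ x → irr x
  }
  where
  symm : ∀ x y → not (E G x y) ∧ not ⌊ x ≟ y ⌋ ≡ not (E G y x) ∧ not ⌊ y ≟ x ⌋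
  symm x y rewrite E-sym G x y | ⌊≟⌋-sym x y = refl
  irr : ∀ x → not (E G x x) ∧ not ⌊ x ≟ x ⌋ ≡ false
  irr x rewrite ⌊≟⌋-refl x = ∧-false (not (E G x x))

data Walk {n : ℕ} (G : Graph n) : Fin n → Fin n → ℕ → Set where
  nil  : ∀ {x} → Walk G x x 0
  cons : ∀ {x y z k} → E G x y ≡ true → Walk G y z k → Walk G x z (suc k)

Connected : ∀ {n} → Graph n → Set
Connected G = ∀ x y → ∃[ k ] Walk G x y k

Dist : ∀ {n} → Graph n → Fin n → Fin n → ℕ → Set
Dist G x y d = Walk G x y d × (∀ m → m < d → ¬ Walk G x y m)

Diameter : ∀ {n} → Graph n → ℕ → Set
Diameter H D =
  (∀ x y → ∃[ d ] (Dist H x y d × d ≤ D)) × (∃[ x ] ∃[ y ] Dist H x y D)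

StronglyResolves : ∀ {n} → Graph n → Fin n → Fin n → Fin n → Set
StronglyResolves H w u v =
  ∃[ a ] ∃[ b ] ∃[ c ]
    (Dist H u w a × Dist H u v b × Dist H v w c ×
     ((a ≡ b + c) ⊎ (c ≡ b + a)))

IsStrongMetricGenerator : ∀ {n} → Graph n → Subset n → Set
IsStrongMetricGenerator H S =
  ∀ u v → u ≢ v → ∃[ w ] (w ∈ S × StronglyResolves H w u v)

IsVertexCover : ∀ {n} → Graph n → Subset n → Set
IsVertexCover G S = ∀ x y → E G x y ≡ true → x ∈ S ⊎ y ∈ S

IsMinCard : ∀ {n} → (Subset n → Set) → ℕ → Set
IsMinCard P k = (∃[ S ] (P S × ∣ S ∣ ≡ k)) × (∀ S → P S → k ≤ ∣ S ∣)

IsStrongDim : ∀ {n} → Graph n → ℕ → Set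
IsStrongDim H = IsMinCard (IsStrongMetricGenerator H)

IsSimStrongDim : ∀ {n} → Graph n → Graph n → ℕ → Set
IsSimStrongDim G₁ G₂ =
  IsMinCard (λ S → IsStrongMetricGenerator G₁ S × IsStrongMetricGenerator G₂ S)

IsVertexCoverNumber : ∀ {n} → Graph n → ℕ → Set
IsVertexCoverNumber G = IsMinCard (IsVertexCover G)

module Submission where

-- When D(Gᶜ) = 2, the two endpoints of an edge of G are at distance 2 in Gᶜ,
-- and no third vertex within distance 2 of both can strongly resolve them; so every
-- strong metric generator of Gᶜ is a vertex cover of G. Conversely, a vertex cover S
-- of G that strongly resolves G also strongly resolves Gᶜ: two vertices outside S are
-- adjacent in Gᶜ, and either some (necessarily covering) vertex x is a G-neighbour of
-- exactly one of them, and then x strongly resolves them in Gᶜ with distances 2 = 1 + 1,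
-- or they are twins in G, and then nothing outside them strongly resolves them in G.
-- Hence the simultaneous strong metric generators of G and Gᶜ are exactly the strong
-- metric generators of G that are vertex covers, and both equivalences follow.

open import Defs
open import Data.Nat using (ℕ; zero; suc; _+_; _≤_; _<_; z≤n; s≤s)
open import Data.Nat.Properties
  using (≤-antisym; ≮⇒≥; <⇒≱; <⇒≢; m<m+n; m<n+m; +-identityʳ)
open import Data.Fin using (Fin; _≟_)
open import Data.Fin.Properties using (all?; ¬∀⟶∃¬)
open import Data.Fin.Subset using (Subset; _∈_; ∣_∣)
open import Data.Fin.Subset.Properties using (_∈?_)
open import Data.Bool using (true; false)
import Data.Bool.Properties as Bool
open import Data.Product using (_×_; _,_; proj₁; proj₂; ∃; ∃-syntax)
import Data.Product
open import Data.Sum using (_⊎_; inj₁; inj₂; [_,_]′)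
import Data.Sum
open import Data.Empty using (⊥-elim)
open import Function using (_∘_)
open import Function.Bundles using (_⇔_; mk⇔)
open import Relation.Nullary using (¬_; yes; no)
open import Relation.Binary.PropositionalEquality using (_≡_; _≢_; refl; sym; trans; subst)

private
  variable
    n a b c d k : ℕ
    G : Graph n
    u v w x y z : Fin n

IsMinCard-×-≡⇔ : {P Q R : Subset n → Set} {r p : ℕ} →
  (∀ {S} → R S → P S × Q S) → (∀ {S} → P S → Q S → R S) →
  IsMinCard R r → IsMinCard P p →
  (r ≡ p) ⇔ (∃[ S ] (P S × ∣ S ∣ ≡ p × Q S))
IsMinCard-×-≡⇔ R⇒P×Q P⇒Q⇒R ((S , RS , ∣S∣≡r) , R-min) (_ , P-min) = mk⇔
  (λ r≡p → S , proj₁ (R⇒P×Q RS) , trans ∣S∣≡r r≡p , proj₂ (R⇒P×Q RS))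
  (λ (T , PT , ∣T∣≡p , QT) → ≤-antisym
    (subst (_ ≤_) ∣T∣≡p (R-min T (P⇒Q⇒R PT QT)))
    (subst (_ ≤_) ∣S∣≡r (P-min S (proj₁ (R⇒P×Q RS)))))

edge⇒≢ : E G x y ≡ true → x ≢ y
edge⇒≢ {G = G} {x} exy refl with trans (sym exy) (E-irr G x)
... | ()

snoc : Walk G x y k → E G y z ≡ true → Walk G x z (suc k)
snoc nil       e′ = cons e′ nil
snoc (cons e p) e′ = cons e (snoc p e′)

reverse : Walk G x y k → Walk G y x k
reverse nil = nil
reverse {G = G} (cons {x = x} {y = y} e p) = snoc (reverse p) (trans (E-sym G y x) e)

Walk-length-0⇒≡ : Walk G x y 0 → x ≡ y
Walk-length-0⇒≡ nil = refl

Dist-refl : Dist G x x 0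
Dist-refl = nil , λ _ ()

Dist-sym : Dist G x y d → Dist G y x d
Dist-sym (p , shortest) = reverse p , λ m m<d → shortest m m<d ∘ reverse

Dist-edge : E G x y ≡ true → Dist G x y 1
Dist-edge {G = G} exy =
  cons exy nil , λ { zero _ → edge⇒≢ {G = G} exy ∘ Walk-length-0⇒≡ ; (suc _) (s≤s ()) }

Dist-unique : Dist G x y a → Dist G x y b → a ≡ b
Dist-unique (p , p-shortest) (q , q-shortest) =
  ≤-antisym (≮⇒≥ (λ b<a → p-shortest _ b<a q)) (≮⇒≥ (λ a<b → q-shortest _ a<b p))

Dist-pos : Dist G x y d → x ≢ y → 0 < d
Dist-pos (nil , _)      x≢y = ⊥-elim (x≢y refl)
Dist-pos (cons _ _ , _) _   = s≤s z≤n

Dist≤Diameter : Diameter G d → Dist G x y a → a ≤ d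
Dist≤Diameter {x = x} {y} diam dist with proj₁ diam x y
... | _ , dist′ , d′≤d = subst (_≤ _) (sym (Dist-unique dist dist′)) d′≤d

Diameter⇒Dist : Diameter G d → ∀ x y → ∃ (Dist G x y)
Diameter⇒Dist diam x y with proj₁ diam x y
... | a , dist , _ = a , dist

resolver-strictly-farther : Dist G u w a → Dist G u v b → Dist G v w c →
  (a ≡ b + c) ⊎ (c ≡ b + a) → u ≢ v → w ≢ u → w ≢ v →
  (b < a × c < a) ⊎ (b < c × a < c)
resolver-strictly-farther {b = b} {c = c} duw duv dvw (inj₁ refl) u≢v _ w≢v =
  inj₁ (m<m+n b (Dist-pos dvw (w≢v ∘ sym)) , m<n+m c (Dist-pos duv u≢v))
resolver-strictly-farther {a = a} {b = b} duw duv dvw (inj₂ refl) u≢v w≢u _ =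
  inj₂ (m<m+n b (Dist-pos duw (w≢u ∘ sym)) , m<n+m a (Dist-pos duv u≢v))

StronglyResolves-sym : StronglyResolves G w u v → StronglyResolves G w v u
StronglyResolves-sym (a , b , c , duw , duv , dvw , r) =
  c , b , a , dvw , Dist-sym duv , duw , Data.Sum.swap r

endpoint-resolves : Dist G u v b → StronglyResolves G v u v
endpoint-resolves {b = b} duv = b , b , 0 , duv , duv , Dist-refl , inj₁ (sym (+-identityʳ b))

Twins : Graph n → Fin n → Fin n → Set
Twins G u v = ∀ x → E G u x ≡ E G v x

twins-or-distinguishing-neighbour : (G : Graph n) (u v : Fin n) →
  Twins G u v ⊎ ∃[ x ] ((E G u x ≡ true × E G v x ≡ false) ⊎ (E G v x ≡ true × E G u x ≡ false))
twins-or-distinguishing-neighbour {n} G u v with all? (λ x → E G u x Bool.≟ E G v x)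
... | yes twins = inj₁ twins
... | no ¬twins with ¬∀⟶∃¬ n _ (λ x → E G u x Bool.≟ E G v x) ¬twins
...   | x , ux≢vx with E G u x in ux | E G v x in vx
...     | true  | false = inj₂ (x , inj₁ (ux , vx))
...     | false | true  = inj₂ (x , inj₂ (vx , ux))
...     | true  | true  = ⊥-elim (ux≢vx refl)
...     | false | false = ⊥-elim (ux≢vx refl)

twin-Walk : Twins G u v → u ≢ w → Walk G u w k → Walk G v w k
twin-Walk twins u≢w nil = ⊥-elim (u≢w refl)
twin-Walk twins _ (cons {y = y} e p) = cons (trans (sym (twins y)) e) p

twin-Dist : Twins G u v → u ≢ w → v ≢ w → Dist G u w d → Dist G v w d
twin-Dist twins u≢w v≢w (p , shortest) =
  twin-Walk twins u≢w p , λ m m<d → shortest m m<d ∘ twin-Walk (sym ∘ twins) v≢w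

twins-resolved-only-by-themselves : Twins G u v → u ≢ v → StronglyResolves G w u v → w ≡ u ⊎ w ≡ v
twins-resolved-only-by-themselves {u = u} {v} {w} twins u≢v (a , b , c , duw , duv , dvw , r)
  with w ≟ u | w ≟ v
... | yes w≡u | _       = inj₁ w≡u
... | no _    | yes w≡v = inj₂ w≡v
... | no w≢u  | no w≢v  = ⊥-elim ([ (λ (_ , c<a) → <⇒≢ c<a (sym a≡c)) , (λ (_ , a<c) → <⇒≢ a<c a≡c) ]′
                                   (resolver-strictly-farther duw duv dvw r u≢v w≢u w≢v))
  where
  a≡c : a ≡ c
  a≡c = Dist-unique (twin-Dist twins (w≢u ∘ sym) (w≢v ∘ sym) duw) dvw

complement-edge : E G x y ≡ false → x ≢ y → E (complement G) x y ≡ true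
complement-edge {x = x} {y} exy x≢y with x ≟ y
... | yes x≡y = ⊥-elim (x≢y x≡y)
... | no _ rewrite exy = refl

complement-edge⇒non-edge : E (complement G) x y ≡ true → E G x y ≡ false
complement-edge⇒non-edge {G = G} {x} {y} e with E G x y
... | false = refl

edge⇒complement-Walk-long : E G x y ≡ true → Walk (complement G) x y k → 2 ≤ k
edge⇒complement-Walk-long {G = G} exy nil = ⊥-elim (edge⇒≢ {G = G} exy refl)
edge⇒complement-Walk-long {G = G} exy (cons e nil) with trans (sym exy) (complement-edge⇒non-edge {G = G} e)
... | ()
edge⇒complement-Walk-long exy (cons _ (cons _ _)) = s≤s (s≤s z≤n)

edge⇒complement-Dist≡2 : Diameter (complement G) 2 → E G x y ≡ true → Dist (complement G) x y 2
edge⇒complement-Dist≡2 {G = G} {x} {y} diam exy with Diameter⇒Dist diam x y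
... | _ , dist@(p , _) with ≤-antisym (Dist≤Diameter diam dist) (edge⇒complement-Walk-long {G = G} exy p)
... | refl = dist

distinguishing-neighbour-resolves : Diameter (complement G) 2 → E G u v ≡ false → u ≢ v →
  E G u x ≡ true → E G v x ≡ false → StronglyResolves (complement G) x u v
distinguishing-neighbour-resolves {G = G} {u} {v} {x} diam euv u≢v eux evx =
  2 , 1 , 1 , edge⇒complement-Dist≡2 diam eux , Dist-edge (complement-edge {G = G} euv u≢v)
    , Dist-edge (complement-edge {G = G} evx v≢x) , inj₁ refl
  where
  v≢x : v ≢ x
  v≢x refl with trans (sym eux) euv
  ... | ()

∈⇒≢∉ : {S : Subset n} → w ∈ S → ¬ (x ∈ S) → w ≢ x
∈⇒≢∉ {S = S} w∈S x∉S w≡x = x∉S (subst (_∈ S) w≡x w∈S)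

module _ {S : Subset n} (cover : IsVertexCover G S) where

  VertexCover-uncovered-non-edge : ¬ (x ∈ S) → ¬ (y ∈ S) → E G x y ≡ false
  VertexCover-uncovered-non-edge x∉S y∉S = Bool.¬-not (λ exy → [ x∉S , y∉S ]′ (cover _ _ exy))

  VertexCover-neighbour-of-uncovered : ¬ (x ∈ S) → E G x y ≡ true → y ∈ S
  VertexCover-neighbour-of-uncovered x∉S exy = [ (λ x∈S → ⊥-elim (x∉S x∈S)) , (λ y∈S → y∈S) ]′ (cover _ _ exy)

complement-StrongMetricGenerator⇒VertexCover : Diameter (complement G) 2 →
  {S : Subset n} → IsStrongMetricGenerator (complement G) S → IsVertexCover G S
complement-StrongMetricGenerator⇒VertexCover {G = G} diam {S} gen x y exy with x ∈? S | y ∈? S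
... | yes x∈S | _       = inj₁ x∈S
... | no _    | yes y∈S = inj₂ y∈S
... | no x∉S  | no y∉S  with gen x y (edge⇒≢ {G = G} exy)
...   | w , w∈S , a , b , c , dxw , dxy , dyw , r = ⊥-elim
  ([ (λ (b<a , _) → <⇒≱ (subst (_< a) b≡2 b<a) (Dist≤Diameter diam dxw))
   , (λ (b<c , _) → <⇒≱ (subst (_< c) b≡2 b<c) (Dist≤Diameter diam dyw)) ]′
   (resolver-strictly-farther dxw dxy dyw r (edge⇒≢ {G = G} exy) (∈⇒≢∉ w∈S x∉S) (∈⇒≢∉ w∈S y∉S)))
  where
  b≡2 : b ≡ 2
  b≡2 = Dist-unique dxy (edge⇒complement-Dist≡2 diam exy)

VertexCover×StrongMetricGenerator⇒complement-StrongMetricGenerator : Diameter (complement G) 2 →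
  {S : Subset n} → IsVertexCover G S → IsStrongMetricGenerator G S → IsStrongMetricGenerator (complement G) S
VertexCover×StrongMetricGenerator⇒complement-StrongMetricGenerator {G = G} diam {S} cover gen u v u≢v
  with u ∈? S | v ∈? S
... | yes u∈S | _       = u , u∈S , StronglyResolves-sym (endpoint-resolves (proj₂ (Diameter⇒Dist diam v u)))
... | no _    | yes v∈S = v , v∈S , endpoint-resolves (proj₂ (Diameter⇒Dist diam u v))
... | no u∉S  | no v∉S  with twins-or-distinguishing-neighbour G u v
...   | inj₁ twins = ⊥-elim
  (let (w , w∈S , res) = gen u v u≢v in
   [ (λ w≡u → ∈⇒≢∉ w∈S u∉S w≡u) , (λ w≡v → ∈⇒≢∉ w∈S v∉S w≡v) ]′ (twins-resolved-only-by-themselves twins u≢v res))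
...   | inj₂ (x , inj₁ (eux , evx)) =
  x , VertexCover-neighbour-of-uncovered {G = G} cover u∉S eux ,
  distinguishing-neighbour-resolves diam (VertexCover-uncovered-non-edge {G = G} cover u∉S v∉S) u≢v eux evx
...   | inj₂ (x , inj₂ (evx , eux)) =
  x , VertexCover-neighbour-of-uncovered {G = G} cover v∉S evx ,
  StronglyResolves-sym (distinguishing-neighbour-resolves diam
    (VertexCover-uncovered-non-edge {G = G} cover v∉S u∉S) (u≢v ∘ sym) evx eux)

mainTheorem17 : ∀ {n} (G : Graph n) → Connected G → Diameter (complement G) 2 →
    ∀ (sd ds b : ℕ) → IsSimStrongDim G (complement G) sd → IsStrongDim G ds →
    IsVertexCoverNumber G b →
    ((sd ≡ ds) ⇔ (∃[ S ] (IsStrongMetricGenerator G S × ∣ S ∣ ≡ ds × IsVertexCover G S)))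
    × ((sd ≡ b) ⇔ (∃[ S ] (IsVertexCover G S × ∣ S ∣ ≡ b × IsStrongMetricGenerator G S)))
mainTheorem17 G _ diam _ _ _ isSd isDs isβ =
  IsMinCard-×-≡⇔ simultaneous⇒ (λ gen cover → gen , toComplement cover gen) isSd isDs ,
  IsMinCard-×-≡⇔ (Data.Product.swap ∘ simultaneous⇒) (λ cover gen → gen , toComplement cover gen) isSd isβ
  where
  toComplement : ∀ {S} → IsVertexCover G S → IsStrongMetricGenerator G S →
                 IsStrongMetricGenerator (complement G) S
  toComplement = VertexCover×StrongMetricGenerator⇒complement-StrongMetricGenerator diam
  simultaneous⇒ : ∀ {S} → IsStrongMetricGenerator G S × IsStrongMetricGenerator (complement G) S →
                  IsStrongMetricGenerator G S × IsVertexCover G S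
  simultaneous⇒ (gen , genᶜ) = gen , complement-StrongMetricGenerator⇒VertexCover diam genᶜ
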